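{- Let $p\ge3$ be prime and $s$ an odd positive integer with $s<2p$, and let $\Gamma_s=\Delta_{2p,2p-s}$. Then the set of all odd elements of $\mathbb Z/2p\mathbb Z$, namely $\{1,3,5,\dots,2p-1\}$, is a face of $\Gamma_s$.
   Context: For integers $0<\ell<n$, $\Delta_{n,\ell}$ is the simplicial complex of all subsets $S\subseteq\mathbb Z/n\mathbb Z$ such that there are no nonnegative integers $c_s$ ($s\in S$) with $\sum_{s\in S}c_s=\ell$ and $\sum_{s\in S}c_s s=0$ in $\mathbb Z/n\mathbb Z$. An element $N\in\mathbb Z/2p\mathbb Z$ is even if $N=2M$ for some $M\in\mathbb Z/2p\mathbb Z$, and odd otherwise. -}

module Defs where

open import Data.Nat using (ℕ; zero; suc; _+_; _*_; _∸_; _<_; _≤_; NonZero)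
open import Data.Nat.DivMod using (_%_)
open import Data.Fin using (Fin; toℕ)
open import Data.Vec.Functional using (foldr)
open import Data.Product using (∃; _×_)
open import Relation.Binary.PropositionalEquality using (_≡_)
open import Relation.Nullary using (¬_)

sumFin : ∀ {n} → (Fin n → ℕ) → ℕ
sumFin f = foldr _+_ 0 f

-- Elements of ℤ/nℤ are represented by Fin n (residues 0,…,n-1).
-- S is a face of Δ_{n,ℓ}: there are no nonnegative integers c_s (s ∈ S)
-- with Σ c_s = ℓ and Σ c_s s ≡ 0 (mod n).  We encode the family (c_s)_{s∈S}
-- as c : Fin n → ℕ vanishing outside S.
IsFace : (n ℓ : ℕ) → .{{NonZero n}} → (Fin n → Set) → Set
IsFace n ℓ S =
  ¬ (∃ λ (c : Fin n → ℕ) →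
       (∀ x → ¬ S x → c x ≡ 0)
     × sumFin c ≡ ℓ
     × (sumFin (λ x → c x * toℕ x)) % n ≡ 0)

IsEven : (n : ℕ) → .{{NonZero n}} → Fin n → Set
IsEven n N = ∃ λ (M : Fin n) → (2 * toℕ M) % n ≡ toℕ N

IsOdd : (n : ℕ) → .{{NonZero n}} → Fin n → Set
IsOdd n N = ¬ IsEven n N

-- The odd residues modulo an even n are exactly the odd numbers below n, so a weighting c
-- supported on them has Σ c_x x ≡ Σ c_x (mod 2).  If Σ c_x x ≡ 0 (mod n) with n even, then
-- ℓ = Σ c_x is even; but ℓ = n − s with s odd is odd.
module Submission where

open import Defs
open import Data.Nat using (ℕ; zero; suc; _+_; _*_; _∸_; _<_; _≤_; NonZero; _%_; s≤s; _≟_)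
open import Data.Nat.Properties using (*-comm; ≤-<-trans; <⇒≤; m≤m*n; *-identityʳ; m∸n+n≡m)
open import Data.Nat.DivMod using (%-distribˡ-+; %-distribˡ-*; m%n%n≡m%n; m<n⇒m%n≡m; m%n<n)
open import Data.Nat.Divisibility
  using (_∣_; divides; m%n≡0⇒n∣m; n∣m⇒m%n≡0; ∣n∣m%n⇒∣m; ∣m+n∣m⇒∣n; m∣m*n; _∣0)
open import Data.Nat.Primality using (Prime)
open import Data.Fin using (Fin; toℕ; fromℕ<)
import Data.Fin as Fin
open import Data.Fin.Properties using (toℕ<n; toℕ-fromℕ<)
open import Data.Vec.Functional using (head; tail)
open import Data.Product using (_,_)
open import Data.Empty using (⊥-elim)
open import Function using (_∘_)
open import Relation.Binary.PropositionalEquality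
open import Relation.Nullary using (¬_; yes; no)

sumFin-cong-% : ∀ d .{{_ : NonZero d}} {n} (f g : Fin n → ℕ) →
  (∀ x → f x % d ≡ g x % d) → sumFin f % d ≡ sumFin g % d
sumFin-cong-% d {zero} f g f≡g = refl
sumFin-cong-% d {suc n} f g f≡g = begin
    (head f + sumFin (tail f)) % d
  ≡⟨ %-distribˡ-+ (head f) _ d ⟩
    (head f % d + sumFin (tail f) % d) % d
  ≡⟨ cong₂ (λ a b → (a + b) % d) (f≡g Fin.zero) (sumFin-cong-% d (tail f) (tail g) (f≡g ∘ Fin.suc)) ⟩
    (head g % d + sumFin (tail g) % d) % d
  ≡⟨ %-distribˡ-+ (head g) _ d ⟨
    (head g + sumFin (tail g)) % d ∎
  where open ≡-Reasoning

n%d≡1⇒m*n%d≡m%d : ∀ m n d .{{_ : NonZero d}} → n % d ≡ 1 → (m * n) % d ≡ m % d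
n%d≡1⇒m*n%d≡m%d m n d n%d≡1 = begin
  (m * n) % d             ≡⟨ %-distribˡ-* m n d ⟩
  ((m % d) * (n % d)) % d ≡⟨ cong (λ k → ((m % d) * k) % d) n%d≡1 ⟩
  ((m % d) * 1) % d       ≡⟨ cong (_% d) (*-identityʳ (m % d)) ⟩
  (m % d) % d             ≡⟨ m%n%n≡m%n m d ⟩
  m % d                   ∎
  where open ≡-Reasoning

2∣toℕ⇒IsEven : ∀ n .{{_ : NonZero n}} (x : Fin n) → 2 ∣ toℕ x → IsEven n x
2∣toℕ⇒IsEven n x (divides q x≡q*2) = fromℕ< q<n , (begin
  (2 * toℕ (fromℕ< q<n)) % n ≡⟨ cong (λ k → (2 * k) % n) (toℕ-fromℕ< q<n) ⟩
  (2 * q) % n                ≡⟨ cong (_% n) (trans (*-comm 2 q) (sym x≡q*2)) ⟩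
  toℕ x % n                  ≡⟨ m<n⇒m%n≡m (toℕ<n x) ⟩
  toℕ x                      ∎)
  where
  open ≡-Reasoning
  q<n : q < n
  q<n = ≤-<-trans (subst (q ≤_) (sym x≡q*2) (m≤m*n q 2)) (toℕ<n x)

IsOdd⇒toℕ%2≡1 : ∀ n .{{_ : NonZero n}} (x : Fin n) → IsOdd n x → toℕ x % 2 ≡ 1
IsOdd⇒toℕ%2≡1 n x odd with toℕ x % 2 in x%2≡r | m%n<n (toℕ x) 2
... | 0           | _               = ⊥-elim (odd (2∣toℕ⇒IsEven n x (m%n≡0⇒n∣m (toℕ x) 2 x%2≡r)))
... | 1           | _               = refl
... | suc (suc _) | s≤s (s≤s ())

weightedSum-on-odds-%2 : ∀ n .{{_ : NonZero n}} (c : Fin n → ℕ) →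
  (∀ x → ¬ IsOdd n x → c x ≡ 0) →
  sumFin (λ x → c x * toℕ x) % 2 ≡ sumFin c % 2
weightedSum-on-odds-%2 n c supported = sumFin-cong-% 2 _ c term
  where
  term : ∀ x → (c x * toℕ x) % 2 ≡ c x % 2
  term x with c x ≟ 0
  ... | yes cx≡0 rewrite cx≡0 = refl
  ... | no cx≢0  = n%d≡1⇒m*n%d≡m%d (c x) (toℕ x) 2
                     (IsOdd⇒toℕ%2≡1 n x (λ even → cx≢0 (supported x (λ odd → odd even))))

odds-isFace : ∀ n .{{_ : NonZero n}} s → 2 ∣ n → ¬ 2 ∣ s → s ≤ n →
  IsFace n (n ∸ s) (IsOdd n)
odds-isFace n s 2∣n 2∤s s≤n (c , supported , Σc≡n∸s , Σcx%n≡0) = 2∤s 2∣s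
  where
  2∣Σcx : 2 ∣ sumFin (λ x → c x * toℕ x)
  2∣Σcx = ∣n∣m%n⇒∣m 2∣n (subst (2 ∣_) (sym Σcx%n≡0) (2 ∣0))
  2∣n∸s : 2 ∣ n ∸ s
  2∣n∸s = m%n≡0⇒n∣m (n ∸ s) 2 (begin
    (n ∸ s) % 2                          ≡⟨ cong (_% 2) Σc≡n∸s ⟨
    sumFin c % 2                         ≡⟨ weightedSum-on-odds-%2 n c supported ⟨
    sumFin (λ x → c x * toℕ x) % 2       ≡⟨ n∣m⇒m%n≡0 _ 2 2∣Σcx ⟩
    0                                    ∎)
    where open ≡-Reasoning
  2∣s : 2 ∣ s
  2∣s = ∣m+n∣m⇒∣n (subst (2 ∣_) (sym (m∸n+n≡m s≤n)) 2∣n) 2∣n∸s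

lemma4p2 : (p s : ℕ) → .{{_ : NonZero (2 * p)}} → Prime p → 3 ≤ p →
    1 ≤ s → ¬ (2 ∣ s) → s < 2 * p →
    IsFace (2 * p) (2 * p ∸ s) (IsOdd (2 * p))
lemma4p2 p s _ _ _ 2∤s s<2p = odds-isFace (2 * p) s (m∣m*n p) 2∤s (<⇒≤ s<2p)
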